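{- In the quantum 2-torus $T_q^2(\mathbb F)$ (notation in context), for any $(u,v)\in\Phi^2$ and any $m,k,r,s\in\mathbb N$, $$\langle q^s\mathbf v(q^mv,u)\,|\,q^r\mathbf u(q^ku,v)\rangle=q^{r-s-km}$$ and $$\langle q^r\mathbf u(q^ku,v)\,|\,q^s\mathbf v(q^mv,u)\rangle=q^{km+s-r}=\langle q^s\mathbf v(q^mv,u)\,|\,q^r\mathbf u(q^ku,v)\rangle^{ -1}.$$
   Context: Let $\mathbb F$ be a field of characteristic zero, $q\in\mathbb F^*$ not a root of unity, $\Gamma=q^{\mathbb Z}$. Fix a choice function $\phi:\mathbb F^*/\Gamma\to\mathbb F^*$ ($\phi(x\Gamma)\in x\Gamma$) with range $\Phi$. For $(u,v)\in\Phi^2$, $\gamma\in\Gamma$ take linearly independent vectors $\mathbf u(\gamma u,v)$ and $\mathbf v(\gamma v,u)$ of a large $\mathbb F$-module; put $\mathbf U=\{\gamma_1\mathbf u(\gamma_2u,v)\}$, $\mathbf V=\{\gamma_1\mathbf v(\gamma_2v,u)\}$ ($\gamma_i\in\Gamma$, $(u,v)\in\Phi^2$). Operators act linearly: $U\mathbf u(\gamma u,v)=\gamma u\,\mathbf u(\gamma u,v)$, $V\mathbf u(\gamma u,v)=v\,\mathbf u(q^{ -1}\gamma u,v)$, $U\mathbf v(\gamma v,u)=u\,\mathbf v(q\gamma v,u)$, $V\mathbf v(\gamma v,u)=\gamma v\,\mathbf v(\gamma v,u)$, with the corresponding inverses $U^{ -1},V^{ -1}$. The pairing is a partial function $\langle\cdot|\cdot\rangle:(\mathbf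 V\times\mathbf U)\cup(\mathbf U\times\mathbf V)\to\Gamma$ postulated to satisfy: (1) $\langle\mathbf u(u,v)|\mathbf v(v,u)\rangle=1$; (2) $\langle U^rV^s\mathbf u(u,v)|U^rV^s\mathbf v(v,u)\rangle=1$ for all $r,s\in\mathbb Z$; (3) $\langle\gamma_1\mathbf u(\gamma_2u,v)|\gamma_3\mathbf v(\gamma_4v,u)\rangle=\langle\gamma_3\mathbf v(\gamma_4v,u)|\gamma_1\mathbf u(\gamma_2u,v)\rangle^{ -1}$; (4) $\langle\gamma_1\mathbf u(\gamma_2u,v)|\gamma_3\mathbf v(\gamma_4v,u)\rangle=\gamma_1^{ -1}\gamma_3\langle\mathbf u(\gamma_2u,v)|\mathbf v(\gamma_4v,u)\rangle$ for $\gamma_i\in\Gamma$; (5) the pairing of $q^s\mathbf v(v',u)$ with $q^r\mathbf u(u',v)$ is undefined when $v'\notin\Gamma v$ or $u'\notin\Gamma u$. The quantum 2-torus $T_q^2(\mathbb F)$ is the multi-sorted structure $(\mathbf U,\mathbf V,\langle\cdot|\cdot\rangle,\mathbb F)$ with these operators and pairing. -}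

module Defs where

open import Level using (Level; _⊔_) renaming (suc to lsuc)
open import Data.Nat using (ℕ; zero; suc)
open import Data.Integer as ℤ using (ℤ; +_; -[1+_])
open import Data.Product using (Σ; ∃; _×_; _,_; proj₁; proj₂)
open import Relation.Nullary using (¬_)
open import Relation.Binary.PropositionalEquality using (_≡_)
open import Algebra.Bundles using (CommutativeRing)

-- A field (with a total inverse function, 0⁻¹ unspecified) of
-- characteristic zero.

record Field (c ℓ : Level) : Set (lsuc (c ⊔ ℓ)) where
  field
    commutativeRing : CommutativeRing c ℓ
  open CommutativeRing commutativeRing public
  field
    _⁻¹       : Carrier → Carrier
    ⁻¹-inverse : ∀ x → ¬ (x ≈ 0#) → x * (x ⁻¹) ≈ 1#
    1≉0       : ¬ (1# ≈ 0#)

  ℕ→F : ℕ → Carrier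
  ℕ→F zero    = 0#
  ℕ→F (suc n) = 1# + ℕ→F n

  infixr 8 _^ℕ_
  _^ℕ_ : Carrier → ℕ → Carrier
  x ^ℕ zero  = 1#
  x ^ℕ suc n = x * (x ^ℕ n)

  _^ℤ_ : Carrier → ℤ → Carrier
  x ^ℤ (+ n)     = x ^ℕ n
  x ^ℤ -[1+ n ]  = (x ⁻¹) ^ℕ suc n

CharZero : ∀ {c ℓ} → Field c ℓ → Set ℓ
CharZero F = ∀ n → ¬ (ℕ→F (suc n) ≈ 0#)
  where open Field F

NotRootOfUnity : ∀ {c ℓ} (F : Field c ℓ) → Field.Carrier F → Set ℓ
NotRootOfUnity F q = ¬ (q ≈ 0#) × (∀ n → ¬ (q ^ℕ suc n ≈ 1#))
  where open Field F

-- A u-type vector  c · u(q^b u , v)  is represented by  uvec c b,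
-- a v-type vector  c · v(q^d v , u)  by  vvec c d,
-- for a fixed pair (u , v) (given as field elements).

module Ops {c ℓ} (F : Field c ℓ) (q : Field.Carrier F) where
  open Field F

  record UVec : Set c where
    constructor uvec
    field
      coef : Carrier
      idx  : ℤ

  record VVec : Set c where
    constructor vvec
    field
      coef : Carrier
      idx  : ℤ

  module _ (u v : Carrier) where
    -- U u(γu,v) = γu u(γu,v),  V u(γu,v) = v u(q⁻¹γu,v)
    Uᵘ Vᵘ U⁻¹ᵘ V⁻¹ᵘ : UVec → UVec
    Uᵘ   (uvec a b) = uvec (a * ((q ^ℤ b) * u)) b
    U⁻¹ᵘ (uvec a b) = uvec (a * (((q ^ℤ b) * u) ⁻¹)) b
    Vᵘ   (uvec a b) = uvec (a * v) (b ℤ.- ℤ.+ 1)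
    V⁻¹ᵘ (uvec a b) = uvec (a * (v ⁻¹)) (b ℤ.+ ℤ.+ 1)

    -- U v(γv,u) = u v(qγv,u),  V v(γv,u) = γv v(γv,u)
    Uᵛ Vᵛ U⁻¹ᵛ V⁻¹ᵛ : VVec → VVec
    Uᵛ   (vvec a d) = vvec (a * u) (d ℤ.+ ℤ.+ 1)
    U⁻¹ᵛ (vvec a d) = vvec (a * (u ⁻¹)) (d ℤ.- ℤ.+ 1)
    Vᵛ   (vvec a d) = vvec (a * ((q ^ℤ d) * v)) d
    V⁻¹ᵛ (vvec a d) = vvec (a * (((q ^ℤ d) * v) ⁻¹)) d

  iter : ∀ {A : Set c} → (A → A) → ℕ → A → A
  iter f zero    x = x
  iter f (suc n) x = f (iter f n x)

  powOp : ∀ {A : Set c} → (A → A) → (A → A) → ℤ → A → A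
  powOp f g (+ n)    = iter f n
  powOp f g -[1+ n ] = iter g (suc n)

  UVᵘ : (u v : Carrier) → ℤ → ℤ → UVec → UVec
  UVᵘ u v r s x = powOp (Uᵘ u v) (U⁻¹ᵘ u v) r (powOp (Vᵘ u v) (V⁻¹ᵘ u v) s x)

  UVᵛ : (u v : Carrier) → ℤ → ℤ → VVec → VVec
  UVᵛ u v r s y = powOp (Uᵛ u v) (U⁻¹ᵛ u v) r (powOp (Vᵛ u v) (V⁻¹ᵛ u v) s y)

-- The quantum 2-torus T_q^2(F).
--  * Γ = q^ℤ ≅ ℤ (q not a root of unity); an element q^n of Γ is
--    represented by its exponent n : ℤ, so the pairing is ℤ-valued.
--  * Φ is the range of a choice function φ : F*/Γ → F*, encoded as a
--    map φ on F* that is constant on Γ-cosets and picks an element of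
--    the coset; Φ = { x ≠ 0 | φ x = x }.
--  * Since Φ is a transversal of F*/Γ, by axiom (5) the pairing is
--    defined exactly on pairs built from the same (u , v) ∈ Φ².
--    pairUV u v a b c d  =  exponent of ⟨q^a u(q^b u,v) | q^c v(q^d v,u)⟩
--    pairVU u v c d a b  =  exponent of ⟨q^c v(q^d v,u) | q^a u(q^b u,v)⟩

record QuantumTorus {c ℓ} (F : Field c ℓ) : Set (lsuc (c ⊔ ℓ)) where
  open Field F
  field
    charZero   : CharZero F
    q          : Carrier
    q-notRoot  : NotRootOfUnity F q
    φ          : Carrier → Carrier
    φ-coset    : ∀ x → ¬ (x ≈ 0#) → ∃ λ n → φ x ≈ x * (q ^ℤ n)
    φ-constant : ∀ x n → ¬ (x ≈ 0#) → φ (x * (q ^ℤ n)) ≈ φ x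

  Φ : Set (c ⊔ ℓ)
  Φ = Σ Carrier λ x → ¬ (x ≈ 0#) × (φ x ≈ x)

  open Ops F q public

  field
    pairUV : Φ → Φ → ℤ → ℤ → ℤ → ℤ → ℤ
    pairVU : Φ → Φ → ℤ → ℤ → ℤ → ℤ → ℤ
    ax1 : ∀ u v → pairUV u v (+ 0) (+ 0) (+ 0) (+ 0) ≡ + 0
    -- (2) ⟨U^r V^s u(u,v) | U^r V^s v(v,u)⟩ = 1, where the pairing is
    --     extended to F*-multiples by rule (4): ⟨a x | b y⟩ = a⁻¹ b ⟨x|y⟩
    ax2 : ∀ u v r s →
      let X = UVᵘ (proj₁ u) (proj₁ v) r s (uvec 1# (+ 0))
          Y = UVᵛ (proj₁ u) (proj₁ v) r s (vvec 1# (+ 0))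
      in ((UVec.coef X) ⁻¹) * (VVec.coef Y)
           * (q ^ℤ pairUV u v (+ 0) (UVec.idx X) (+ 0) (VVec.idx Y)) ≈ 1#
    ax3 : ∀ u v a b c' d → pairUV u v a b c' d ≡ ℤ.- pairVU u v c' d a b
    ax4 : ∀ u v a b c' d →
      pairUV u v a b c' d ≡ (ℤ.- a) ℤ.+ c' ℤ.+ pairUV u v (+ 0) b (+ 0) d

-- Everything reduces to the values ⟨u(q^k u,v) | v(q^m v,u)⟩ on basis vectors, which axiom (2) pins
-- down: U^m V^-k sends u(u,v) to (v⁻¹)^k (q^k u)^m · u(q^k u,v) and v(v,u) to (v⁻¹)^k u^m · v(q^m v,u),
-- so the two coefficients differ by the factor q^(km), and axiom (2) forces the pairing to be q^(km)
-- (exponents are unique because q is not a root of unity). Axioms (4) and (3) then give the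
-- general values.
module Submission where

open import Defs
open import Data.Integer using (ℤ; +_; _+_; _-_; _*_; -_)
open import Data.Nat using (ℕ)
open import Data.Product using (_×_)
open import Relation.Binary.PropositionalEquality using (_≡_)

import Data.Nat as ℕ
open import Data.Nat.Properties using () renaming (+-comm to ℕ+-comm)
import Data.Integer as ℤ
open import Data.Integer.Properties using (pos-*; neg-involutive)
open import Data.Integer.Solver using (module +-*-Solver)
open import Data.Product using (_,_; proj₁; proj₂)
open import Data.Empty using (⊥-elim)
open import Function using (_∘_)
open import Relation.Binary.PropositionalEquality as ≡ using (cong; subst₂)
import Algebra.Properties.CommutativeSemiring.Exp as Exp
import Algebra.Properties.CommutativeSemigroup as CommutativeSemigroupProperties
import Relation.Binary.Reasoning.Setoid as SetoidReasoning

module FieldProperties {c ℓ} (F : Field c ℓ) where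
  open Field F renaming (_*_ to _·_)
  open Exp commutativeSemiring public using (_^_; ^-homo-*; ^-assocʳ; ^-distrib-*)
  open CommutativeSemigroupProperties *-commutativeSemigroup using (interchange)
  open SetoidReasoning setoid

  ^ℕ≗^ : ∀ x n → x ^ℕ n ≡ x ^ n
  ^ℕ≗^ x ℕ.zero    = ≡.refl
  ^ℕ≗^ x (ℕ.suc n) = cong (x ·_) (^ℕ≗^ x n)

  ⁻¹-inverseˡ : ∀ {x} → x ≉ 0# → x ⁻¹ · x ≈ 1#
  ⁻¹-inverseˡ {x} x≉0 = trans (*-comm _ _) (⁻¹-inverse x x≉0)

  ·-cancelˡ : ∀ {x a b} → x ≉ 0# → x · a ≈ x · b → a ≈ b
  ·-cancelˡ {x} {a} {b} x≉0 xa≈xb = begin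
    a                ≈⟨ *-identityˡ a ⟨
    1# · a           ≈⟨ *-congʳ (⁻¹-inverseˡ x≉0) ⟨
    (x ⁻¹ · x) · a   ≈⟨ *-assoc _ _ _ ⟩
    x ⁻¹ · (x · a)   ≈⟨ *-congˡ xa≈xb ⟩
    x ⁻¹ · (x · b)   ≈⟨ *-assoc _ _ _ ⟨
    (x ⁻¹ · x) · b   ≈⟨ *-congʳ (⁻¹-inverseˡ x≉0) ⟩
    1# · b           ≈⟨ *-identityˡ b ⟩
    b                ∎

  ·-nonzero : ∀ {x y} → x ≉ 0# → y ≉ 0# → x · y ≉ 0#
  ·-nonzero {x} x≉0 y≉0 xy≈0 = y≉0 (·-cancelˡ x≉0 (trans xy≈0 (sym (zeroʳ x))))

  ⁻¹-nonzero : ∀ {x} → x ≉ 0# → x ⁻¹ ≉ 0#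
  ⁻¹-nonzero {x} x≉0 x⁻¹≈0 =
    1≉0 (trans (sym (⁻¹-inverse x x≉0)) (trans (*-congˡ x⁻¹≈0) (zeroʳ x)))

  ^-nonzero : ∀ {x} → x ≉ 0# → ∀ n → x ^ n ≉ 0#
  ^-nonzero x≉0 ℕ.zero    = 1≉0
  ^-nonzero x≉0 (ℕ.suc n) = ·-nonzero x≉0 (^-nonzero x≉0 n)

  -- The inverse is an arbitrary function in Field, so it respects ≈ only away from 0.
  ⁻¹-cong : ∀ {x y} → x ≉ 0# → x ≈ y → x ⁻¹ ≈ y ⁻¹
  ⁻¹-cong {x} {y} x≉0 x≈y = ·-cancelˡ y≉0 (begin
    y · x ⁻¹   ≈⟨ *-congʳ x≈y ⟨
    x · x ⁻¹   ≈⟨ ⁻¹-inverse x x≉0 ⟩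
    1#         ≈⟨ ⁻¹-inverse y y≉0 ⟨
    y · y ⁻¹   ∎)
    where
      y≉0 : y ≉ 0#
      y≉0 y≈0 = x≉0 (trans x≈y y≈0)

  ^-inverse : ∀ {x} → x ≉ 0# → ∀ n → x ^ n · (x ⁻¹) ^ n ≈ 1#
  ^-inverse x≉0 ℕ.zero    = *-identityˡ 1#
  ^-inverse {x} x≉0 (ℕ.suc n) = begin
    (x · x ^ n) · (x ⁻¹ · x ⁻¹ ^ n)   ≈⟨ interchange _ _ _ _ ⟩
    (x · x ⁻¹) · (x ^ n · x ⁻¹ ^ n)   ≈⟨ *-cong (⁻¹-inverse x x≉0) (^-inverse x≉0 n) ⟩
    1# · 1#                           ≈⟨ *-identityˡ 1# ⟩
    1#                                ∎

  [a⁻¹·b]·x≈1⇒x≈c : ∀ {a b c x} → a ≉ 0# → b ≉ 0# → a ≈ b · c → (a ⁻¹ · b) · x ≈ 1# → x ≈ c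
  [a⁻¹·b]·x≈1⇒x≈c {a} {b} {c} {x} a≉0 b≉0 a≈bc a⁻¹bx≈1 = ·-cancelˡ b≉0 (begin
    b · x                   ≈⟨ *-identityˡ _ ⟨
    1# · (b · x)            ≈⟨ *-congʳ (⁻¹-inverse a a≉0) ⟨
    (a · a ⁻¹) · (b · x)    ≈⟨ *-assoc _ _ _ ⟩
    a · (a ⁻¹ · (b · x))    ≈⟨ *-congˡ (*-assoc _ _ _) ⟨
    a · ((a ⁻¹ · b) · x)    ≈⟨ *-congˡ a⁻¹bx≈1 ⟩
    a · 1#                  ≈⟨ *-identityʳ a ⟩
    a                       ≈⟨ a≈bc ⟩
    b · c                   ∎)

module PowersOfNonRootOfUnity {c ℓ} (F : Field c ℓ) (q : Field.Carrier F)
                              (q-notRoot : NotRootOfUnity F q) where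
  open Field F renaming (_*_ to _·_)
  open FieldProperties F
  open SetoidReasoning setoid

  q≉0 : q ≉ 0#
  q≉0 = proj₁ q-notRoot

  q^suc≉1 : ∀ n → q ^ℕ ℕ.suc n ≉ 1#
  q^suc≉1 = proj₂ q-notRoot

  ^ℕ-injective : ∀ m n → q ^ℕ m ≈ q ^ℕ n → m ≡ n
  ^ℕ-injective ℕ.zero    ℕ.zero    _          = ≡.refl
  ^ℕ-injective ℕ.zero    (ℕ.suc n) 1≈q^sn     = ⊥-elim (q^suc≉1 n (sym 1≈q^sn))
  ^ℕ-injective (ℕ.suc m) ℕ.zero    q^sm≈1     = ⊥-elim (q^suc≉1 m q^sm≈1)
  ^ℕ-injective (ℕ.suc m) (ℕ.suc n) q^sm≈q^sn =
    cong ℕ.suc (^ℕ-injective m n (·-cancelˡ q≉0 q^sm≈q^sn))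

  ^ℤ-injective : ∀ p n → q ^ℤ p ≈ q ^ℕ n → p ≡ + n
  ^ℤ-injective (+ m)      n q^m≈q^n      = cong +_ (^ℕ-injective m n q^m≈q^n)
  ^ℤ-injective ℤ.-[1+ m ] n q^-[1+m]≈q^n = ⊥-elim (q^suc≉1 (m ℕ.+ n) (begin
    q ^ℕ (ℕ.suc m ℕ.+ n)          ≡⟨ ^ℕ≗^ q (ℕ.suc m ℕ.+ n) ⟩
    q ^ (ℕ.suc m ℕ.+ n)           ≈⟨ ^-homo-* q (ℕ.suc m) n ⟩
    q ^ ℕ.suc m · q ^ n           ≡⟨ cong (q ^ ℕ.suc m ·_) (^ℕ≗^ q n) ⟨
    q ^ ℕ.suc m · q ^ℕ n          ≈⟨ *-congˡ q^-[1+m]≈q^n ⟨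
    q ^ ℕ.suc m · q ⁻¹ ^ℕ ℕ.suc m ≡⟨ cong (q ^ ℕ.suc m ·_) (^ℕ≗^ (q ⁻¹) (ℕ.suc m)) ⟩
    q ^ ℕ.suc m · q ⁻¹ ^ ℕ.suc m  ≈⟨ ^-inverse q≉0 (ℕ.suc m) ⟩
    1#                            ∎))

module Orbits {c ℓ} (F : Field c ℓ) (q u v : Field.Carrier F) where
  open Field F renaming (_*_ to _·_)
  open FieldProperties F
  open Ops F q
  open SetoidReasoning setoid

  iter-·-cong : ∀ {w w′} n a → w ≈ w′ → iter (_· w) n a ≈ iter (_· w′) n a
  iter-·-cong ℕ.zero    a w≈w′ = refl
  iter-·-cong (ℕ.suc n) a w≈w′ = *-cong (iter-·-cong n a w≈w′) w≈w′

  iter-·≈·^ : ∀ w n a → iter (_· w) n a ≈ a · w ^ n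
  iter-·≈·^ w ℕ.zero    a = sym (*-identityʳ a)
  iter-·≈·^ w (ℕ.suc n) a = begin
    iter (_· w) n a · w   ≈⟨ *-congʳ (iter-·≈·^ w n a) ⟩
    (a · w ^ n) · w       ≈⟨ *-assoc _ _ _ ⟩
    a · (w ^ n · w)       ≈⟨ *-congˡ (*-comm _ _) ⟩
    a · w ^ ℕ.suc n       ∎

  iter-·-nonzero : ∀ {w} n {a} → a ≉ 0# → w ≉ 0# → iter (_· w) n a ≉ 0#
  iter-·-nonzero ℕ.zero    a≉0 w≉0 = a≉0
  iter-·-nonzero (ℕ.suc n) a≉0 w≉0 = ·-nonzero (iter-·-nonzero n a≉0 w≉0) w≉0

  powOp-neg : ∀ {A} (f g : A → A) k x → powOp f g (ℤ.- + k) x ≡ iter g k x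
  powOp-neg f g ℕ.zero    x = ≡.refl
  powOp-neg f g (ℕ.suc k) x = ≡.refl

  V⁻ᵏ-on-u : ∀ k → iter (V⁻¹ᵘ u v) k (uvec 1# (+ 0)) ≡ uvec (iter (_· v ⁻¹) k 1#) (+ k)
  V⁻ᵏ-on-u ℕ.zero    = ≡.refl
  V⁻ᵏ-on-u (ℕ.suc k) rewrite V⁻ᵏ-on-u k = cong (uvec (iter (_· v ⁻¹) (ℕ.suc k) 1#) ∘ +_) (ℕ+-comm k 1)

  Uᵐ-on-u : ∀ m a b → iter (Uᵘ u v) m (uvec a b) ≡ uvec (iter (_· (q ^ℤ b · u)) m a) b
  Uᵐ-on-u ℕ.zero    a b = ≡.refl
  Uᵐ-on-u (ℕ.suc m) a b rewrite Uᵐ-on-u m a b = ≡.refl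

  V⁻ᵏ-on-v : ∀ k a d → iter (V⁻¹ᵛ u v) k (vvec a d) ≡ vvec (iter (_· (q ^ℤ d · v) ⁻¹) k a) d
  V⁻ᵏ-on-v ℕ.zero    a d = ≡.refl
  V⁻ᵏ-on-v (ℕ.suc k) a d rewrite V⁻ᵏ-on-v k a d = ≡.refl

  Uᵐ-on-v : ∀ m a → iter (Uᵛ u v) m (vvec a (+ 0)) ≡ vvec (iter (_· u) m a) (+ m)
  Uᵐ-on-v ℕ.zero    a = ≡.refl
  Uᵐ-on-v (ℕ.suc m) a rewrite Uᵐ-on-v m a = cong (vvec (iter (_· u) (ℕ.suc m) a) ∘ +_) (ℕ+-comm m 1)

  -- (1# · v) ⁻¹ is literally what V⁻¹ computes on v(v,u), since q ^ℤ + 0 is 1#.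
  coefᵘ coefᵛ : ℕ → ℕ → Carrier
  coefᵘ m k = iter (_· (q ^ℕ k · u)) m (iter (_· v ⁻¹) k 1#)
  coefᵛ m k = iter (_· u) m (iter (_· (1# · v) ⁻¹) k 1#)

  UᵐV⁻ᵏ-on-u : ∀ m k → UVᵘ u v (+ m) (ℤ.- + k) (uvec 1# (+ 0)) ≡ uvec (coefᵘ m k) (+ k)
  UᵐV⁻ᵏ-on-u m k rewrite powOp-neg (Vᵘ u v) (V⁻¹ᵘ u v) k (uvec 1# (+ 0)) | V⁻ᵏ-on-u k =
    Uᵐ-on-u m _ (+ k)

  UᵐV⁻ᵏ-on-v : ∀ m k → UVᵛ u v (+ m) (ℤ.- + k) (vvec 1# (+ 0)) ≡ vvec (coefᵛ m k) (+ m)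
  UᵐV⁻ᵏ-on-v m k rewrite powOp-neg (Vᵛ u v) (V⁻¹ᵛ u v) k (vvec 1# (+ 0)) | V⁻ᵏ-on-v k 1# (+ 0) =
    Uᵐ-on-v m _

  coefᵛ-nonzero : u ≉ 0# → v ≉ 0# → ∀ m k → coefᵛ m k ≉ 0#
  coefᵛ-nonzero u≉0 v≉0 m k = iter-·-nonzero m (iter-·-nonzero k 1≉0 [1·v]⁻¹≉0) u≉0
    where
      [1·v]⁻¹≉0 : (1# · v) ⁻¹ ≉ 0#
      [1·v]⁻¹≉0 = ⁻¹-nonzero (·-nonzero 1≉0 v≉0)

  coefᵘ≈coefᵛ·q^km : v ≉ 0# → ∀ m k → coefᵘ m k ≈ coefᵛ m k · q ^ (k ℕ.* m)
  coefᵘ≈coefᵛ·q^km v≉0 m k = begin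
    coefᵘ m k                       ≈⟨ iter-·≈·^ _ m C ⟩
    C · (q ^ℕ k · u) ^ m            ≡⟨ cong (λ x → C · (x · u) ^ m) (^ℕ≗^ q k) ⟩
    C · (q ^ k · u) ^ m             ≈⟨ *-congˡ (^-distrib-* _ u m) ⟩
    C · ((q ^ k) ^ m · u ^ m)       ≈⟨ *-congˡ (*-congʳ (^-assocʳ q k m)) ⟩
    C · (q ^ (k ℕ.* m) · u ^ m)     ≈⟨ *-congˡ (*-comm _ _) ⟩
    C · (u ^ m · q ^ (k ℕ.* m))     ≈⟨ *-assoc _ _ _ ⟨
    (C · u ^ m) · q ^ (k ℕ.* m)     ≈⟨ *-congʳ (*-congʳ (iter-·-cong k 1# v⁻¹≈[1·v]⁻¹)) ⟩
    (C′ · u ^ m) · q ^ (k ℕ.* m)    ≈⟨ *-congʳ (iter-·≈·^ u m C′) ⟨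
    coefᵛ m k · q ^ (k ℕ.* m)       ∎
    where
      C C′ : Carrier
      C  = iter (_· v ⁻¹) k 1#
      C′ = iter (_· (1# · v) ⁻¹) k 1#
      v⁻¹≈[1·v]⁻¹ : v ⁻¹ ≈ (1# · v) ⁻¹
      v⁻¹≈[1·v]⁻¹ = ⁻¹-cong v≉0 (sym (*-identityˡ v))

module _ {c ℓ} {F : Field c ℓ} (T : QuantumTorus F) where
  open Field F using (_≈_; _≉_; 0#; 1#; _⁻¹; _^ℤ_; _^ℕ_; setoid; sym; trans; reflexive)
    renaming (_*_ to _·_)
  open import Relation.Binary.Properties.Setoid setoid using (≉-respˡ)
  open QuantumTorus T
  open FieldProperties F
  open PowersOfNonRootOfUnity F q q-notRoot

  pairUV-basis : ∀ (u v : Φ) k m → pairUV u v (+ 0) (+ k) (+ 0) (+ m) ≡ + k * + m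
  pairUV-basis u@(u₀ , u₀≉0 , _) v@(v₀ , v₀≉0 , _) k m =
    ≡.trans (^ℤ-injective _ (k ℕ.* m) q^pair≈q^km) (pos-* k m)
    where
      open Orbits F q u₀ v₀
      axiom2 : ((coefᵘ m k) ⁻¹ · coefᵛ m k) · q ^ℤ pairUV u v (+ 0) (+ k) (+ 0) (+ m) ≈ 1#
      axiom2 = subst₂ (λ X Y → (UVec.coef X ⁻¹ · VVec.coef Y)
                                 · q ^ℤ pairUV u v (+ 0) (UVec.idx X) (+ 0) (VVec.idx Y) ≈ 1#)
                      (UᵐV⁻ᵏ-on-u m k) (UᵐV⁻ᵏ-on-v m k) (ax2 u v (+ m) (ℤ.- + k))
      coefᵛ≉0 : coefᵛ m k ≉ 0#
      coefᵛ≉0 = coefᵛ-nonzero u₀≉0 v₀≉0 m k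
      coefᵘ≉0 : coefᵘ m k ≉ 0#
      coefᵘ≉0 = ≉-respˡ (sym (coefᵘ≈coefᵛ·q^km v₀≉0 m k)) (·-nonzero coefᵛ≉0 (^-nonzero q≉0 (k ℕ.* m)))
      q^pair≈q^km : q ^ℤ pairUV u v (+ 0) (+ k) (+ 0) (+ m) ≈ q ^ℕ (k ℕ.* m)
      q^pair≈q^km = trans ([a⁻¹·b]·x≈1⇒x≈c coefᵘ≉0 coefᵛ≉0 (coefᵘ≈coefᵛ·q^km v₀≉0 m k) axiom2)
                          (reflexive (≡.sym (^ℕ≗^ q (k ℕ.* m))))

mainTheorem2 : ∀ {c ℓ} (F : Field c ℓ) (T : QuantumTorus F) →
    ∀ (u v : QuantumTorus.Φ T) (m k r s : ℕ) →
      (QuantumTorus.pairVU T u v (+ s) (+ m) (+ r) (+ k) ≡ (+ r) - (+ s) - (+ k) * (+ m))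
      × (QuantumTorus.pairUV T u v (+ r) (+ k) (+ s) (+ m) ≡ (+ k) * (+ m) + (+ s) - (+ r))
      × (QuantumTorus.pairUV T u v (+ r) (+ k) (+ s) (+ m) ≡ - QuantumTorus.pairVU T u v (+ s) (+ m) (+ r) (+ k))
mainTheorem2 F T u v m k r s = pairVU-value , pairUV-value , pairUV≡-pairVU
  where
    open QuantumTorus T
    open ≡.≡-Reasoning
    open +-*-Solver

    pairUV≡-pairVU : pairUV u v (+ r) (+ k) (+ s) (+ m) ≡ - pairVU u v (+ s) (+ m) (+ r) (+ k)
    pairUV≡-pairVU = ax3 u v (+ r) (+ k) (+ s) (+ m)

    pairUV-value : pairUV u v (+ r) (+ k) (+ s) (+ m) ≡ + k * + m + + s - + r
    pairUV-value = begin
      pairUV u v (+ r) (+ k) (+ s) (+ m)               ≡⟨ ax4 u v (+ r) (+ k) (+ s) (+ m) ⟩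
      - + r + + s + pairUV u v (+ 0) (+ k) (+ 0) (+ m) ≡⟨ cong (λ p → - + r + + s + p) (pairUV-basis T u v k m) ⟩
      - + r + + s + + k * + m                          ≡⟨ solve 3 (λ R S K → :- R :+ S :+ K := K :+ S :- R) ≡.refl (+ r) (+ s) (+ k * + m) ⟩
      + k * + m + + s - + r                            ∎

    pairVU-value : pairVU u v (+ s) (+ m) (+ r) (+ k) ≡ + r - + s - + k * + m
    pairVU-value = begin
      pairVU u v (+ s) (+ m) (+ r) (+ k)       ≡⟨ neg-involutive _ ⟨
      - - pairVU u v (+ s) (+ m) (+ r) (+ k)   ≡⟨ cong -_ (≡.trans (≡.sym pairUV≡-pairVU) pairUV-value) ⟩
      - (+ k * + m + + s - + r)                ≡⟨ solve 3 (λ R S K → :- (K :+ S :- R) := R :- S :- K) ≡.refl (+ r) (+ s) (+ k * + m) ⟩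
      + r - + s - + k * + m                    ∎
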